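{- For every $n \geq 1$ and all $u, v \in \mathsf{Tr}(n)$, $v$ covers $u$ in $(\mathsf{Tr}(n),\preccurlyeq)$ if and only if $u \preccurlyeq v$, there is exactly one index $i$ with $u_i < v_i$, and there is no $w \in \mathsf{Tr}(n)$ with $u \preccurlyeq w \preccurlyeq v$ other than $w=u$ and $w=v$. In particular, two triwords in a covering relation differ in exactly one letter.
   Context: For $n\ge1$, $\mathsf{Tr}(n)$ is the set of words $u = u_1\cdots u_n$ over $\{0,1,2\}$ with $u_1 \neq 2$ and no indices $i<j$ with $u_i=0$, $u_j=1$, ordered componentwise ($u\preccurlyeq v$ iff $u_i\le v_i$ for all $i$). -}

module Defs where

open import Data.Nat using (ℕ)
open import Data.Fin using (Fin; zero; suc; toℕ; _≤_; _<_)
open import Data.Product using (∃; _×_)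
open import Data.Sum using (_⊎_)
open import Data.Empty using (⊥)
open import Relation.Nullary using (¬_)
open import Relation.Binary.PropositionalEquality using (_≡_)

-- A word u = u_1 ⋯ u_n over the alphabet {0,1,2}: letters are Fin 3
-- (0 = zero, 1 = suc zero, 2 = suc (suc zero)); position i : Fin n is u_{i+1}.
Word : ℕ → Set
Word n = Fin n → Fin 3

IsTri : {n : ℕ} → Word n → Set
IsTri {n} u =
  ((i : Fin n) → toℕ i ≡ 0 → ¬ (u i ≡ suc (suc zero)))
  × ((i j : Fin n) → i < j → u i ≡ zero → u j ≡ suc zero → ⊥)

_≈w_ : {n : ℕ} → Word n → Word n → Set
_≈w_ {n} u v = (i : Fin n) → u i ≡ v i

_≼_ : {n : ℕ} → Word n → Word n → Set
_≼_ {n} u v = (i : Fin n) → u i ≤ v i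

Covers : {n : ℕ} → Word n → Word n → Set
Covers {n} u v =
  (u ≼ v) × ¬ (u ≈w v)
  × ((w : Word n) → IsTri w → u ≼ w → ¬ (u ≈w w) → w ≼ v → ¬ (w ≈w v) → ⊥)

module Submission where

-- If u ≼ v are triwords and m is the smallest index with u_m < v_m, then the
-- word obtained from u by replacing its m-th letter by v_m is again a
-- triword: position m can no longer carry a forbidden 0 (as v_m > u_m ≥ 0),
-- and a forbidden pattern 0…1 ending at m would, since u and v agree before
-- m, already be a forbidden pattern in v.  This word lies strictly above u,
-- and strictly below v as soon as u and v differ at a second index.
--
-- Hence, if v covers u, the index m is the only index where u_i < v_i; and
-- since equality of words is decidable, every triword between u and v is u
-- or v.

open import Defs
open import Data.Nat using (ℕ; _≤_)
import Data.Nat.Properties as ℕ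
open import Data.Fin using (Fin; _<_; zero; suc; toℕ; inject; fromℕ<)
import Data.Fin as F
import Data.Fin.Properties as FP
open import Data.Vec.Functional using (updateAt)
open import Data.Vec.Functional.Properties using (updateAt-updates; updateAt-minimal)
open import Data.Product using (∃; _×_; _,_; proj₁)
open import Data.Sum using (_⊎_; inj₁; inj₂)
open import Data.Empty using (⊥; ⊥-elim)
open import Function using (const)
open import Function.Bundles using (_⇔_; mk⇔)
open import Relation.Nullary using (¬_; yes; no)
open import Relation.Binary.PropositionalEquality using (_≡_; refl; sym; trans; subst)

first-difference : ∀ {n} (u v : Word n) → u ≼ v → ¬ (u ≈w v) →
  ∃ λ m → u m < v m × ((k : Fin n) → k < m → u k ≡ v k)
first-difference {n} u v u≼v u≉v
  with FP.¬∀⟶∃¬-smallest n (λ i → u i ≡ v i) (λ i → u i F.≟ v i) u≉v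
... | m , um≢vm , agree = m , FP.≤∧≢⇒< (u≼v m) um≢vm , agree-below
  where
  -- the library phrases "below m" through Fin (toℕ m); translate back to _<_
  agree-below : (k : Fin n) → k < m → u k ≡ v k
  agree-below k k<m = subst (λ i → u i ≡ v i) inject-fromℕ< (agree (fromℕ< k<m))
    where
    inject-fromℕ< : inject {i = m} (fromℕ< k<m) ≡ k
    inject-fromℕ< = FP.toℕ-injective (trans (FP.toℕ-inject _) (FP.toℕ-fromℕ< k<m))

raise : ∀ {n} → Word n → Fin n → Fin 3 → Word n
raise u m a = updateAt u m (const a)

module RaiseFirstDifference {n : ℕ} (u v : Word n) (u≼v : u ≼ v) (m : Fin n)
    (um<vm : u m < v m) (agree : (k : Fin n) → k < m → u k ≡ v k) where

  w : Word n
  w = raise u m (v m)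

  w-at : w m ≡ v m
  w-at = updateAt-updates m u

  w-off : (k : Fin n) → ¬ k ≡ m → w k ≡ u k
  w-off k k≢m = updateAt-minimal k m u k≢m

  u≼w : u ≼ w
  u≼w k with k F.≟ m
  ... | yes refl = subst (u k F.≤_) (sym w-at) (u≼v k)
  ... | no k≢m   = subst (u k F.≤_) (sym (w-off k k≢m)) FP.≤-refl

  w≼v : w ≼ v
  w≼v k with k F.≟ m
  ... | yes refl = subst (F._≤ v k) (sym w-at) FP.≤-refl
  ... | no k≢m   = subst (F._≤ v k) (sym (w-off k k≢m)) (u≼v k)

  u≉w : ¬ (u ≈w w)
  u≉w u≈w = FP.<⇒≢ um<vm (trans (u≈w m) w-at)

  w≉v : (o : Fin n) → u o < v o → ¬ o ≡ m → ¬ (w ≈w v)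
  w≉v o uo<vo o≢m w≈v = FP.<⇒≢ uo<vo (trans (sym (w-off o o≢m)) (w≈v o))

  -- The raised word is a triword: the first letter is a letter of u or of v,
  -- and a forbidden pattern 0…1 in w would give one in u or in v.
  w-tri : IsTri u → IsTri v → IsTri w
  w-tri (u-first , u-no01) (v-first , v-no01) = w-first , w-no01
    where
    w-first : (i : Fin n) → toℕ i ≡ 0 → ¬ (w i ≡ suc (suc zero))
    w-first i i≡0 wi≡2 with i F.≟ m
    ... | yes refl = v-first i i≡0 (trans (sym w-at) wi≡2)
    ... | no i≢m   = u-first i i≡0 (trans (sym (w-off i i≢m)) wi≡2)

    vm≢0 : ¬ v m ≡ zero
    vm≢0 vm≡0 = ℕ.n≮0 (subst (u m <_) vm≡0 um<vm)

    w-no01 : (i j : Fin n) → i < j → w i ≡ zero → w j ≡ suc zero → ⊥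
    w-no01 i j i<j wi≡0 wj≡1 with i F.≟ m | j F.≟ m
    ... | yes refl | _        = vm≢0 (trans (sym w-at) wi≡0)
    ... | no i≢m   | yes refl =
      v-no01 i m i<j (trans (sym (agree i i<j)) (trans (sym (w-off i i≢m)) wi≡0))
                     (trans (sym w-at) wj≡1)
    ... | no i≢m   | no j≢m   =
      u-no01 i j i<j (trans (sym (w-off i i≢m)) wi≡0) (trans (sym (w-off j j≢m)) wj≡1)

covers⇒unique-strict-index : ∀ {n} (u v : Word n) → IsTri u → IsTri v → Covers u v →
  ∃ λ i → u i < v i × ((j : Fin n) → u j < v j → j ≡ i)
covers⇒unique-strict-index {n} u v tu tv (u≼v , u≉v , no-middle)
  with first-difference u v u≼v u≉v
... | m , um<vm , agree = m , um<vm , unique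
  where
  open RaiseFirstDifference u v u≼v m um<vm agree
  unique : (j : Fin n) → u j < v j → j ≡ m
  unique j uj<vj with j F.≟ m
  ... | yes j≡m = j≡m
  ... | no j≢m  = ⊥-elim (no-middle w (w-tri tu tv) u≼w u≉w w≼v (w≉v j uj<vj j≢m))

covers⇒trivial-interval : ∀ {n} (u v : Word n) → Covers u v →
  (w : Word n) → IsTri w → u ≼ w → w ≼ v → (w ≈w u) ⊎ (w ≈w v)
covers⇒trivial-interval u v (_ , _ , no-middle) w tw u≼w w≼v
  with FP.all? (λ k → w k F.≟ u k) | FP.all? (λ k → w k F.≟ v k)
... | yes w≈u | _       = inj₁ w≈u
... | no _    | yes w≈v = inj₂ w≈v
... | no w≉u  | no w≉v  = ⊥-elim (no-middle w tw u≼w (λ u≈w → w≉u (λ k → sym (u≈w k))) w≼v w≉v)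

trivial-interval⇒covers : ∀ {n} (u v : Word n) → u ≼ v → (∃ λ i → u i < v i) →
  ((w : Word n) → IsTri w → u ≼ w → w ≼ v → (w ≈w u) ⊎ (w ≈w v)) → Covers u v
trivial-interval⇒covers u v u≼v (i , ui<vi) interval =
  u≼v , (λ u≈v → FP.<⇒≢ ui<vi (u≈v i)) , no-middle
  where
  no-middle : ∀ w → IsTri w → u ≼ w → ¬ (u ≈w w) → w ≼ v → ¬ (w ≈w v) → ⊥
  no-middle w tw u≼w u≉w w≼v w≉v with interval w tw u≼w w≼v
  ... | inj₁ w≈u = u≉w (λ k → sym (w≈u k))
  ... | inj₂ w≈v = w≉v w≈v

unique-strict⇒unique-difference : ∀ {n} (u v : Word n) → u ≼ v →
  (∃ λ i → u i < v i × ((j : Fin n) → u j < v j → j ≡ i)) →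
  ∃ λ i → ¬ (u i ≡ v i) × ((j : Fin n) → ¬ (u j ≡ v j) → j ≡ i)
unique-strict⇒unique-difference u v u≼v (i , ui<vi , unique) =
  i , FP.<⇒≢ ui<vi , λ j uj≢vj → unique j (FP.≤∧≢⇒< (u≼v j) uj≢vj)

CoverCriterion : ∀ {n} → Word n → Word n → Set
CoverCriterion {n} u v =
  (u ≼ v)
  × (∃ λ i → (u i < v i) × ((j : Fin n) → u j < v j → j ≡ i))
  × ((w : Word n) → IsTri w → u ≼ w → w ≼ v → (w ≈w u) ⊎ (w ≈w v))

proposition1p3 : (n : ℕ) → 1 ≤ n → (u v : Word n) → IsTri u → IsTri v →
    (Covers u v ⇔
      ((u ≼ v)
       × (∃ λ i → (u i < v i) × ((j : Fin n) → u j < v j → j ≡ i))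
       × ((w : Word n) → IsTri w → u ≼ w → w ≼ v → (w ≈w u) ⊎ (w ≈w v))))
    × (Covers u v → ∃ λ i → ¬ (u i ≡ v i) × ((j : Fin n) → ¬ (u j ≡ v j) → j ≡ i))
proposition1p3 n _ u v tu tv = mk⇔ forward backward , differ-once
  where
  forward : Covers u v → CoverCriterion u v
  forward c = proj₁ c , covers⇒unique-strict-index u v tu tv c , covers⇒trivial-interval u v c

  backward : CoverCriterion u v → Covers u v
  backward (u≼v , (i , ui<vi , _) , interval) =
    trivial-interval⇒covers u v u≼v (i , ui<vi) interval

  differ-once : Covers u v → ∃ λ i → ¬ (u i ≡ v i) × ((j : Fin n) → ¬ (u j ≡ v j) → j ≡ i)
  differ-once c =
    unique-strict⇒unique-difference u v (proj₁ c) (covers⇒unique-strict-index u v tu tv c)
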